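{- For every integer $k\ge 9$, the path $P_k$ defines each of the graphs $F_2$, $B_1$ and $S(2,1)$; that is, for each such graph $H$ there is a coalition partition $\Psi$ of $P_k$ with $\mathrm{CG}(P_k,\Psi)\cong H$.
   Context: For a graph $G$ with vertex set $V$, a set $S\subseteq V$ is a dominating set if every vertex of $V\setminus S$ is adjacent to a vertex of $S$. Two disjoint sets $V_1,V_2\subseteq V$ form a coalition in $G$ if neither is a dominating set of $G$ but $V_1\cup V_2$ is. A coalition partition of $G$ is a partition $\Psi=\{V_1,\ldots,V_k\}$ of $V$ such that every $V_i\in\Psi$ is either a dominating set of $G$ with $|V_i|=1$, or is not a dominating set and forms a coalition with some $V_j\in\Psi$. Given a coalition partition $\Psi$ of $G$, the coalition graph $\mathrm{CG}(G,\Psi)$ has vertex set $\Psi$, two members adjacent iff they form a coalition in $G$. $P_k$ is the path on $k$ vertices. $F_2$ is a $4$-cycle with one pendant edge attached; $B_1$ (the bull graph) is a triangle with pendant edges attached at two distinct vertices; $S(2,1)$ is the double star: a tree with exactly two adjacent non-leaf vertices, one having $2$ leaf neighbors and the other $1$ leaf neighbor. -}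

module Defs where

open import Data.Nat using (ℕ; suc; _+_)
open import Data.Fin using (Fin; toℕ)
open import Data.Fin using (zero) renaming (suc to fsuc)
open import Data.Product using (Σ; ∃; _×_; _,_)
open import Data.Sum using (_⊎_)
open import Data.List using (List; []; _∷_)
open import Data.List.Membership.Propositional using (_∈_)
open import Relation.Binary.PropositionalEquality using (_≡_; _≢_)
open import Relation.Nullary using (¬_)
open import Function.Bundles using (_⇔_; _↔_; Inverse)

Graph : ℕ → Set₁
Graph n = Fin n → Fin n → Set

Path : (k : ℕ) → Graph k
Path k i j = (suc (toℕ i) ≡ toℕ j) ⊎ (suc (toℕ j) ≡ toℕ i)

fromEdges : {n : ℕ} → List (Fin n × Fin n) → Graph n
fromEdges es i j = ((i , j) ∈ es) ⊎ ((j , i) ∈ es)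

module _ {n : ℕ} (G : Graph n) where

  Dominating : (Fin n → Set) → Set
  Dominating S = ∀ v → ¬ S v → ∃ λ u → S u × G u v

  -- Partition of V into m (nonempty) classes, given by a surjective labelling.
  module _ {m : ℕ} (f : Fin n → Fin m) where

    Class : Fin m → Fin n → Set
    Class i v = f v ≡ i

    Coalition : Fin m → Fin m → Set
    Coalition i j =
      i ≢ j × ¬ Dominating (Class i) × ¬ Dominating (Class j)
        × Dominating (λ v → Class i v ⊎ Class j v)

    IsPartition : Set
    IsPartition = ∀ i → ∃ λ v → f v ≡ i

    Singleton : Fin m → Set
    Singleton i = ∃ λ v → ∀ u → (f u ≡ i) ⇔ (u ≡ v)

    IsCoalitionPartition : Set
    IsCoalitionPartition =
      IsPartition ×
      (∀ i → (Dominating (Class i) × Singleton i)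
           ⊎ (¬ Dominating (Class i) × ∃ λ j → Coalition i j))

    CG : Graph m
    CG = Coalition

_≅_ : {m h : ℕ} → Graph m → Graph h → Set
_≅_ {m} {h} A B = Σ (Fin m ↔ Fin h) λ σ →
  ∀ i j → A i j ⇔ B (Inverse.to σ i) (Inverse.to σ j)

Defines : {n h : ℕ} → Graph n → Graph h → Set
Defines {n} G H = ∃ λ m → Σ (Fin n → Fin m) λ f →
  IsCoalitionPartition G f × (CG G f ≅ H)

v0 v1 v2 v3 v4 : Fin 5
v0 = zero
v1 = fsuc zero
v2 = fsuc (fsuc zero)
v3 = fsuc (fsuc (fsuc zero))
v4 = fsuc (fsuc (fsuc (fsuc zero)))

-- F₂: 4-cycle 0-1-2-3-0 with pendant edge 0-4.
F₂ : Graph 5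
F₂ = fromEdges ((v0 , v1) ∷ (v1 , v2) ∷ (v2 , v3) ∷ (v3 , v0) ∷ (v0 , v4) ∷ [])

-- B₁ (bull): triangle 0,1,2 with pendants 3-0 and 4-1.
B₁ : Graph 5
B₁ = fromEdges ((v0 , v1) ∷ (v1 , v2) ∷ (v2 , v0) ∷ (v0 , v3) ∷ (v1 , v4) ∷ [])

-- S(2,1): centres 0,1 adjacent; 0 has leaves 2,3; 1 has leaf 4.
S[2,1] : Graph 5
S[2,1] = fromEdges ((v0 , v1) ∷ (v0 , v2) ∷ (v0 , v3) ∷ (v1 , v4) ∷ [])

-- Colour P_k by the sequence c₀ c₁ … c_{r-1} a b a b … and take the colour classes as the
-- partition. Two facts make every relevant property of this partition checkable on the first
-- nine vertices, uniformly in k ≥ 9. A set of colours containing a or b dominates the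
-- alternating tail, so it dominates P_k as soon as it dominates the prefix; and a set fails to
-- dominate as soon as some vertex among the first nine has no colour of the set in its closed
-- neighbourhood.
module Submission where

open import Defs
open import Data.Nat using (ℕ; _≤_)
open import Data.Product using (_×_)

open import Data.Nat using (zero; suc; _<_; _+_; _∸_)
open import Data.Nat.Properties
  using (≤-trans; n≤1+n; +-suc; m+[n∸m]≡n; ≮⇒≥; _<?_; anyUpTo?; allUpTo?)
open import Data.Fin using (Fin; toℕ; fromℕ<; inject₁; _≟_) renaming (suc to fsuc)
open import Data.Fin.Properties using (toℕ<n; toℕ-fromℕ<; toℕ-inject₁; all?; any?)
open import Data.List using (List; []; _∷_; length)
open import Data.List.Membership.DecPropositional using (_∈?_)
open import Data.Product using (∃; _,_)
open import Data.Product.Properties using (≡-dec)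
open import Data.Sum using (_⊎_; inj₁; inj₂; swap)
open import Data.Empty using (⊥; ⊥-elim)
open import Function using (_∘_)
open import Function.Bundles using (_⇔_; mk⇔; Equivalence)
open import Function.Construct.Identity using (↔-id)
open import Relation.Binary.PropositionalEquality using (_≡_; _≢_; refl; sym; trans; cong; subst)
open import Relation.Nullary using (¬_; Dec; yes; no)
open import Relation.Nullary.Decidable using (True; toWitness; map′; ¬?; _×-dec_; _⊎-dec_)
open import Relation.Unary using (Decidable)

fromEdges? : ∀ {n} (es : List (Fin n × Fin n)) i j → Dec (fromEdges es i j)
fromEdges? es i j = _∈?_ (≡-dec _≟_ _≟_) (i , j) es ⊎-dec _∈?_ (≡-dec _≟_ _≟_) (j , i) es

LeftIn : (ℕ → Set) → ℕ → Set
LeftIn S zero    = ⊥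
LeftIn S (suc p) = S p

Dominated : ℕ → (ℕ → Set) → ℕ → Set
Dominated k S n = S n ⊎ LeftIn S n ⊎ (suc n < k × S (suc n))

Undominated : ℕ → (ℕ → Set) → ℕ → Set
Undominated k S w = suc w < k × ¬ S w × ¬ LeftIn S w × ¬ S (suc w)

leftIn? : {S : ℕ → Set} → Decidable S → Decidable (LeftIn S)
leftIn? S? zero    = no λ ()
leftIn? S? (suc p) = S? p

dominated? : ∀ {S : ℕ → Set} → Decidable S → ∀ k → Decidable (Dominated k S)
dominated? S? k n = S? n ⊎-dec leftIn? S? n ⊎-dec (suc n <? k ×-dec S? (suc n))

undominated? : ∀ {S : ℕ → Set} → Decidable S → ∀ k → Decidable (Undominated k S)
undominated? S? k w = suc w <? k ×-dec ¬? (S? w) ×-dec ¬? (leftIn? S? w) ×-dec ¬? (S? (suc w))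

dominated-mono : ∀ {j k S n} → j ≤ k → Dominated j S n → Dominated k S n
dominated-mono j≤k (inj₁ s)                = inj₁ s
dominated-mono j≤k (inj₂ (inj₁ s))         = inj₂ (inj₁ s)
dominated-mono j≤k (inj₂ (inj₂ (lt , s)))  = inj₂ (inj₂ (≤-trans lt j≤k , s))

undominated-mono : ∀ {j k S w} → j ≤ k → Undominated j S w → Undominated k S w
undominated-mono j≤k (lt , rest) = ≤-trans lt j≤k , rest

left-neighbour : ∀ {k} (S : ℕ → Set) (v : Fin k) → LeftIn S (toℕ v) →
                 ∃ λ u → S (toℕ u) × Path k u v
left-neighbour S (fsuc u) s =
  inject₁ u , subst S (sym (toℕ-inject₁ u)) s , inj₁ (cong suc (toℕ-inject₁ u))

right-neighbour : ∀ {k} (S : ℕ → Set) (v : Fin k) (lt : suc (toℕ v) < k) → S (suc (toℕ v)) →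
                  ∃ λ u → S (toℕ u) × Path k u v
right-neighbour S v lt s = fromℕ< lt , subst S (sym (toℕ-fromℕ< lt)) s , inj₂ (sym (toℕ-fromℕ< lt))

dominating-path : ∀ {k} (S : ℕ → Set) → (∀ n → n < k → Dominated k S n) →
                  Dominating (Path k) (S ∘ toℕ)
dominating-path S dom v v∉S with dom (toℕ v) (toℕ<n v)
... | inj₁ v∈S              = ⊥-elim (v∉S v∈S)
... | inj₂ (inj₁ left)      = left-neighbour S v left
... | inj₂ (inj₂ (lt , s))  = right-neighbour S v lt s

¬dominating-path : ∀ {k} (S : ℕ → Set) w → Undominated k S w → ¬ Dominating (Path k) (S ∘ toℕ)
¬dominating-path S w (lt , w∉S , ¬left , ¬right) dom
  with dom (fromℕ< w<k) (w∉S ∘ subst S (toℕ-fromℕ< w<k))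
  where w<k = ≤-trans (n≤1+n (suc w)) lt
... | u , s , inj₁ e = ¬left (subst (LeftIn S) (trans e (toℕ-fromℕ< _)) s)
... | u , s , inj₂ e = ¬right (subst S (sym (trans (cong suc (sym (toℕ-fromℕ< _))) e)) s)

module _ {A : Set} where

  alternating : A → A → ℕ → A
  alternating a b zero    = a
  alternating a b (suc n) = alternating b a n

  prefixed : List A → (ℕ → A) → ℕ → A
  prefixed []       t n       = t n
  prefixed (x ∷ xs) t zero    = x
  prefixed (x ∷ xs) t (suc n) = prefixed xs t n

  prefixed-tail : ∀ xs t m → prefixed xs t (length xs + m) ≡ t m
  prefixed-tail []       t m = refl
  prefixed-tail (x ∷ xs) t m = prefixed-tail xs t m

  alternating-meets : ∀ {S : A → Set} {a b} → S a ⊎ S b → ∀ n →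
                      S (alternating a b n) ⊎ S (alternating a b (suc n))
  alternating-meets h zero    = h
  alternating-meets {S} {a} {b} h (suc n) = alternating-meets {S} {b} {a} (swap h) n

  tail-dominated : ∀ {k} xs a b (S : A → Set) → S a ⊎ S b → ∀ m →
                   Dominated k (S ∘ prefixed xs (alternating a b)) (suc (length xs + m))
  tail-dominated xs a b S h m with alternating-meets {S} h m
  ... | inj₁ s = inj₂ (inj₁ (subst S (sym (prefixed-tail xs (alternating a b) m)) s))
  ... | inj₂ s = inj₁ (subst S (sym colour-next) s)
    where
    colour-next : prefixed xs (alternating a b) (suc (length xs + m)) ≡ alternating a b (suc m)
    colour-next = trans (cong (prefixed xs (alternating a b)) (sym (+-suc (length xs) m)))
                        (prefixed-tail xs (alternating a b) (suc m))

module Certified {m : ℕ} (xs : List (Fin m)) (a b : Fin m) (B : ℕ) where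

  colour : ℕ → Fin m
  colour = prefixed xs (alternating a b)

  DominatesPaths : (Fin m → Set) → Set
  DominatesPaths S = (S a ⊎ S b) × (∀ {n} → n < suc (length xs) → Dominated B (S ∘ colour) n)

  MissesPaths : (Fin m → Set) → Set
  MissesPaths S = ∃ λ w → w < B × Undominated B (S ∘ colour) w

  dominatesPaths? : ∀ {S} → Decidable S → Dec (DominatesPaths S)
  dominatesPaths? S? =
    (S? a ⊎-dec S? b) ×-dec allUpTo? (dominated? (S? ∘ colour) B) (suc (length xs))

  missesPaths? : ∀ {S} → Decidable S → Dec (MissesPaths S)
  missesPaths? S? = anyUpTo? (undominated? (S? ∘ colour) B) B

  dominatesPaths⇒dominating : ∀ {k S} → B ≤ k → DominatesPaths S →
                              Dominating (Path k) (S ∘ colour ∘ toℕ)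
  dominatesPaths⇒dominating {k} {S} B≤k (ab , prefix) = dominating-path (S ∘ colour) dominated
    where
    dominated : ∀ n → n < k → Dominated k (S ∘ colour) n
    dominated n _ with n <? suc (length xs)
    ... | yes n≤r = dominated-mono B≤k (prefix n≤r)
    ... | no  n>r = subst (Dominated k (S ∘ colour)) (m+[n∸m]≡n (≮⇒≥ n>r))
                          (tail-dominated xs a b S ab (n ∸ suc (length xs)))

  missesPaths⇒¬dominating : ∀ {k S} → B ≤ k → MissesPaths S →
                            ¬ Dominating (Path k) (S ∘ colour ∘ toℕ)
  missesPaths⇒¬dominating B≤k (w , _ , und) = ¬dominating-path _ w (undominated-mono B≤k und)

  Pair : Fin m → Fin m → Fin m → Set
  Pair i j c = c ≡ i ⊎ c ≡ j

  EdgeCertificate : Graph m → Fin m → Fin m → Set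
  EdgeCertificate H i j =
      (H i j × i ≢ j × DominatesPaths (Pair i j))
    ⊎ (¬ H i j × (i ≡ j ⊎ MissesPaths (Pair i j)))

  record Valid (H : Graph m) : Set where
    field
      colours-used    : ∀ i → ∃ λ n → n < B × colour n ≡ i
      classes-miss    : ∀ i → MissesPaths (_≡ i)
      has-neighbour   : ∀ i → ∃ (H i)
      certificates    : ∀ i j → EdgeCertificate H i j

  valid? : ∀ {H} → (∀ i j → Dec (H i j)) → Dec (Valid H)
  valid? H? = map′ (λ (u , c , n , e) → record { colours-used = u ; classes-miss = c
                                              ; has-neighbour = n ; certificates = e })
                   (λ v → let open Valid v in colours-used , classes-miss , has-neighbour , certificates)
    (     all? (λ i → anyUpTo? (λ n → colour n ≟ i) B)
    ×-dec all? (λ i → missesPaths? (_≟ i))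
    ×-dec all? (λ i → any? (H? i))
    ×-dec all? (λ i → all? λ j →
            (H? i j ×-dec ¬? (i ≟ j) ×-dec dominatesPaths? (λ c → c ≟ i ⊎-dec c ≟ j))
      ⊎-dec (¬? (H? i j) ×-dec (i ≟ j ⊎-dec missesPaths? (λ c → c ≟ i ⊎-dec c ≟ j)))))

  module _ {H : Graph m} (valid : Valid H) {k : ℕ} (B≤k : B ≤ k) where
    open Valid valid

    colouring : Fin k → Fin m
    colouring = colour ∘ toℕ

    class-¬dominating : ∀ i → ¬ Dominating (Path k) (Class (Path k) colouring i)
    class-¬dominating i = missesPaths⇒¬dominating {S = _≡ i} B≤k (classes-miss i)

    coalition⇔edge : ∀ i j → Coalition (Path k) colouring i j ⇔ H i j
    coalition⇔edge i j with certificates i j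
    ... | inj₁ (h , i≢j , dom) = mk⇔ (λ _ → h) (λ _ →
            i≢j , class-¬dominating i , class-¬dominating j
                , dominatesPaths⇒dominating {S = Pair i j} B≤k dom)
    ... | inj₂ (¬h , inj₁ refl) = mk⇔ (λ (i≢i , _) → ⊥-elim (i≢i refl)) (⊥-elim ∘ ¬h)
    ... | inj₂ (¬h , inj₂ miss) = mk⇔
            (λ (_ , _ , _ , dom) → ⊥-elim (missesPaths⇒¬dominating {S = Pair i j} B≤k miss dom))
            (⊥-elim ∘ ¬h)

    isPartition : IsPartition (Path k) colouring
    isPartition i with colours-used i
    ... | n , n<B , refl = fromℕ< n<k , cong colour (toℕ-fromℕ< n<k)
      where n<k = ≤-trans n<B B≤k

    defines : Defines (Path k) H
    defines = m , colouring
            , (isPartition , λ i → inj₂ (class-¬dominating i , coalition-partner i))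
            , (↔-id _ , coalition⇔edge)
      where
      coalition-partner : ∀ i → ∃ (Coalition (Path k) colouring i)
      coalition-partner i with has-neighbour i
      ... | j , h = j , Equivalence.from (coalition⇔edge i j) h

proposition10 : (k : ℕ) → 9 ≤ k →
    Defines (Path k) F₂ × Defines (Path k) B₁ × Defines (Path k) S[2,1]
proposition10 k 9≤k = realise F₂-edges (v2 ∷ v0 ∷ v1 ∷ v3 ∷ v4 ∷ v1 ∷ v3 ∷ []) v0 v2
                    , realise B₁-edges (v0 ∷ v1 ∷ v4 ∷ v0 ∷ v2 ∷ v1 ∷ v3 ∷ []) v0 v1
                    , realise S[2,1]-edges (v4 ∷ v0 ∷ v1 ∷ v2 ∷ v3 ∷ []) v1 v0
  where
  F₂-edges B₁-edges S[2,1]-edges : List (Fin 5 × Fin 5)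
  F₂-edges     = (v0 , v1) ∷ (v1 , v2) ∷ (v2 , v3) ∷ (v3 , v0) ∷ (v0 , v4) ∷ []
  B₁-edges     = (v0 , v1) ∷ (v1 , v2) ∷ (v2 , v0) ∷ (v0 , v3) ∷ (v1 , v4) ∷ []
  S[2,1]-edges = (v0 , v1) ∷ (v0 , v2) ∷ (v0 , v3) ∷ (v1 , v4) ∷ []

  realise : (es : List (Fin 5 × Fin 5)) (xs : List (Fin 5)) (a b : Fin 5)
            {certified : True (Certified.valid? xs a b 9 (fromEdges? es))} →
            Defines (Path k) (fromEdges es)
  realise es xs a b {certified} = Certified.defines xs a b 9 (toWitness certified) 9≤k
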